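{- Let $n\ge1$, let $\pi$ be a permutation of $[n]$ and let $I_p=\{(\pi(i),-i): i\in[n]\}$ be the corresponding permutation initial tree. Let $S=\mathcal{M}(I_p)$, i.e. the search sequence $S=(\pi(1),\dots,\pi(n))$ whose $i$-th search is key $\pi(i)$ at time $i$, and let $I_f=\emptyset$ be the flat initial tree. Then $\textsc{Greedy}_{I_p}(S)=\textsc{Greedy}_{I_f}(S)$.
   Context: Geometric view of binary search trees: a search sequence $S=(s_1,\dots,s_n)$ of keys in $[n]$ is the point set $\{(s_i,i)\}$ in the plane (x-coordinate = key, y-coordinate = time). The mirror $\mathcal{M}(X)$ of a point set $X$ is its reflection across the $x$-axis: $(a,b)\mapsto(a,-b)$. An initial tree is a finite set of points with negative $y$-coordinates present before any search; the flat initial tree $I_f$ is the empty set. For two points $p,q$ not on a common horizontal or vertical line, $\square_{pq}$ denotes the closed axis-parallel rectangle with corners $p,q$. The algorithm $\textsc{Greedy}$ with initial tree $I$ on $S$: start with $X:=I$; for $i=1,\dots,n$ in order, let $X_{<i}$ be the current set (all points with $y<i$); for every point $z\in X_{<i}$ with $z.x\neq s_i$ such that $\square_{(s_i,i)z}$ contains no point of $X_{<i}\cup\{(s_i,i)\}$ other than its two corners, add the point $(z.x,i)$ (a touched point); then add $(s_i,i)$ and all these touched points to $X$. The cost $\textsc{Greedy}_I(S)$ is $n$ plus the total number of touched points added over all times $1,\dots,n$. -}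

module Defs where

open import Data.Bool using (Bool; true; false; _∧_; _∨_; not)
open import Data.Nat as ℕ using (ℕ; zero; suc; _+_)
open import Data.Integer as ℤ using (ℤ; +_; -[1+_])
open import Data.Product using (_×_; _,_; proj₁; proj₂)
open import Data.List using (List; []; _∷_; map; length; filterᵇ; deduplicate; _++_; foldr)
open import Data.Fin using (Fin; toℕ)
open import Data.List using (allFin)
open import Data.Fin.Permutation using (Permutation′; _⟨$⟩ʳ_)
open import Relation.Nullary.Decidable using (⌊_⌋)
open import Relation.Binary.PropositionalEquality using (_≡_)
import Data.Nat.Properties as ℕP
import Data.Integer.Properties as ℤP
open import Data.Product.Properties using (≡-dec)

-- A point (x , y): x = key (a natural number), y = time (an integer;
-- negative for points of an initial tree).
Point : Set
Point = ℕ × ℤ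

_==ᵖ_ : Point → Point → Bool
p ==ᵖ q = ⌊ ≡-dec ℕP._≟_ ℤP._≟_ p q ⌋

inRect : Point → Point → Point → Bool
inRect (px , py) (qx , qy) (wx , wy) =
  ⌊ (px ℕ.⊓ qx) ℕ.≤? wx ⌋ ∧ ⌊ wx ℕ.≤? (px ℕ.⊔ qx) ⌋ ∧
  ⌊ (py ℤ.⊓ qy) ℤ.≤? wy ⌋ ∧ ⌊ wy ℤ.≤? (py ℤ.⊔ qy) ⌋

allB : {A : Set} → (A → Bool) → List A → Bool
allB f = foldr (λ a b → f a ∧ b) true

emptyRect : List Point → Point → Point → Bool
emptyRect X p z = allB (λ w → not (inRect p z w) ∨ (w ==ᵖ p) ∨ (w ==ᵖ z)) (p ∷ X)

-- keys of the points touched at time i when searching key s,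
-- given the current point set X (all of whose points have y < i);
-- duplicates are removed so that touched points are counted as a set
touchedKeys : List Point → ℕ → ℤ → List ℕ
touchedKeys X s i =
  deduplicate ℕP._≟_
    (map proj₁ (filterᵇ (λ z → not ⌊ proj₁ z ℕP.≟ s ⌋ ∧ emptyRect X (s , i) z) X))

greedyFrom : List Point → ℕ → List ℕ → ℕ
greedyFrom X i [] = 0
greedyFrom X i (s ∷ ss) =
  let T = touchedKeys X s (+ i)
      X' = ((s , + i) ∷ map (λ k → (k , + i)) T) ++ X
  in 1 + length T + greedyFrom X' (suc i) ss

greedyCost : List Point → List ℕ → ℕ
greedyCost I S = greedyFrom I 1 S

flatTree : List Point
flatTree = []

-- key π(i) for i ∈ [n], using 0-based Fin indices: key = toℕ (π ⟨$⟩ʳ j) + 1, j = i - 1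
permKey : {n : ℕ} → Permutation′ n → Fin n → ℕ
permKey π j = suc (toℕ (π ⟨$⟩ʳ j))

permTree : (n : ℕ) → Permutation′ n → List Point
permTree n π = map (λ j → (permKey π j , -[1+ toℕ j ])) (allFin n)

permSeq : (n : ℕ) → Permutation′ n → List ℕ
permSeq n π = map (permKey π) (allFin n)

-- Greedy never touches a point of the mirrored tree, and these points, lying below the time
-- axis, never obstruct a rectangle between the current search point and a point at a positive
-- time; so both runs add the same points at every step.  The mirror point (s_j, -j) is not
-- touched at time i: for j < i the search point (s_j, j) lies in the rectangle, in its own
-- column; for j > i so does the mirror point (s_i, -i) of the current search; for j = i it
-- carries the searched key.
module Submission where

open import Defs
open import Data.Nat using (ℕ; _≤_)
open import Data.Fin.Permutation using (Permutation′)
open import Relation.Binary.PropositionalEquality using (_≡_)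

open import Data.Bool using (Bool; true; false; _∧_; _∨_; not; T; T?)
open import Data.Bool.Properties using (∧-zeroʳ)
open import Data.Nat as ℕ using (suc; _+_; _<_; s≤s)
import Data.Nat.Properties as ℕP
open import Data.Integer as ℤ using (+_; -[1+_]; +≤+; -≤+; -≤-)
import Data.Integer.Properties as ℤP
open import Data.Fin as Fin using (Fin; toℕ)
open import Data.Fin.Properties using (toℕ-injective)
open import Function using (_∘_; id)
open import Data.Product.Properties using (≡-dec)
open import Data.Product using (_×_; _,_; proj₁; proj₂)
open import Data.Sum using (inj₁; inj₂)
open import Data.Unit using (⊤)
open import Data.List
  using (List; []; _∷_; map; length; filterᵇ; deduplicate; _++_; allFin; tabulate)
open import Data.List.Properties using (++-assoc; filter-none)
open import Data.List.Relation.Unary.All as All using (All; []; _∷_)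
open import Data.List.Relation.Unary.All.Properties using (map⁺; tabulate⁺; ++⁺)
open import Data.List.Relation.Unary.Any using (here; there)
open import Data.List.Membership.Propositional using (_∈_)
open import Data.List.Membership.Propositional.Properties
  using (∈-map⁺; ∈-allFin; ∈-++⁺ˡ; ∈-++⁺ʳ)
open import Relation.Binary.Definitions using (tri<; tri≈; tri>)
open import Relation.Binary.PropositionalEquality
  using (_≢_; refl; sym; trans; cong; subst; module ≡-Reasoning)
open import Relation.Nullary.Decidable using (Dec; ⌊_⌋; isYes≗does; dec-true; dec-false)
open import Relation.Nullary.Negation using (¬_)

private
  variable
    A : Set

⌊⌋-true : (a? : Dec A) → A → ⌊ a? ⌋ ≡ true
⌊⌋-true a? a = trans (isYes≗does a?) (dec-true a? a)

⌊⌋-false : (a? : Dec A) → ¬ A → ⌊ a? ⌋ ≡ false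
⌊⌋-false a? ¬a = trans (isYes≗does a?) (dec-false a? ¬a)

allB-true : (f : A → Bool) {xs : List A} →
  All (λ x → f x ≡ true) xs → allB f xs ≡ true
allB-true f []       = refl
allB-true f (e ∷ es) rewrite e = allB-true f es

allB-false : (f : A → Bool) {x : A} {xs : List A} →
  x ∈ xs → f x ≡ false → allB f xs ≡ false
allB-false f {xs = y ∷ _}  (here refl) e rewrite e = refl
allB-false f {xs = y ∷ xs} (there x∈xs) e =
  trans (cong (f y ∧_) (allB-false f x∈xs e)) (∧-zeroʳ (f y))

allB-++ : (f : A → Bool) (xs : List A) {ys : List A} →
  allB f ys ≡ true → allB f (xs ++ ys) ≡ allB f xs
allB-++ f []       e = e
allB-++ f (x ∷ xs) e = cong (f x ∧_) (allB-++ f xs e)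

filterᵇ-++-rejected : (f g : A → Bool) {xs ys : List A} →
  All (λ x → f x ≡ g x) xs → All (λ y → f y ≡ false) ys →
  filterᵇ f (xs ++ ys) ≡ filterᵇ g xs
filterᵇ-++-rejected f g {x ∷ xs} (e ∷ es) rejected with f x | g x
... | true  | true  = cong (x ∷_) (filterᵇ-++-rejected f g es rejected)
... | false | false = filterᵇ-++-rejected f g es rejected
filterᵇ-++-rejected f g {[]} [] rejected =
  filter-none (T? ∘ f) (All.map (λ e → subst T e) rejected)

InRect : Point → Point → Point → Set
InRect (px , py) (qx , qy) (wx , wy) =
  (px ℕ.⊓ qx ℕ.≤ wx × wx ℕ.≤ px ℕ.⊔ qx) × (py ℤ.⊓ qy ℤ.≤ wy × wy ℤ.≤ py ℤ.⊔ qy)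

inRect-complete : ∀ p q w → InRect p q w → inRect p q w ≡ true
inRect-complete (px , py) (qx , qy) (wx , wy) ((x≥ , x≤) , (y≥ , y≤))
  rewrite ⌊⌋-true (px ℕ.⊓ qx ℕ.≤? wx) x≥ | ⌊⌋-true (wx ℕ.≤? px ℕ.⊔ qx) x≤
        | ⌊⌋-true (py ℤ.⊓ qy ℤ.≤? wy) y≥ | ⌊⌋-true (wy ℤ.≤? py ℤ.⊔ qy) y≤ = refl

inRect-below : ∀ p q w →
  ℤ.NonNegative (proj₂ p) → ℤ.NonNegative (proj₂ q) → ℤ.Negative (proj₂ w) → inRect p q w ≡ false
inRect-below (px , + _) (qx , + _) (wx , -[1+ _ ]) _ _ _
  rewrite ∧-zeroʳ ⌊ wx ℕ.≤? px ℕ.⊔ qx ⌋ | ∧-zeroʳ ⌊ px ℕ.⊓ qx ℕ.≤? wx ⌋ = refl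
inRect-below (_ , -[1+ _ ]) _ _ () _ _
inRect-below (_ , + _) (_ , -[1+ _ ]) _ _ () _
inRect-below (_ , + _) (_ , + _) (_ , + _) _ _ ()

nonBlocking : Point → Point → Point → Bool
nonBlocking p z w = not (inRect p z w) ∨ (w ==ᵖ p) ∨ (w ==ᵖ z)

touches : List Point → Point → Point → Bool
touches X p z = not ⌊ proj₁ z ℕP.≟ proj₁ p ⌋ ∧ emptyRect X p z

touches-blocked : ∀ {X} p z w →
  w ∈ X → InRect p z w → w ≢ p → w ≢ z → touches X p z ≡ false
touches-blocked {X} p z w w∈X w∈□ w≢p w≢z =
  trans (cong (not ⌊ proj₁ z ℕP.≟ proj₁ p ⌋ ∧_)
              (allB-false (nonBlocking p z) {xs = p ∷ X} (there w∈X) blocking))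
        (∧-zeroʳ _)
  where
  blocking : nonBlocking p z w ≡ false
  blocking rewrite inRect-complete p z w w∈□
                 | ⌊⌋-false (≡-dec ℕP._≟_ ℤP._≟_ w p) w≢p
                 | ⌊⌋-false (≡-dec ℕP._≟_ ℤP._≟_ w z) w≢z = refl

touches-++-below : ∀ {P I} p z → All (ℤ.Negative ∘ proj₂) I →
  ℤ.NonNegative (proj₂ p) → ℤ.NonNegative (proj₂ z) → touches (P ++ I) p z ≡ touches P p z
touches-++-below {P} p z I<0 p≥0 z≥0 =
  cong (not ⌊ proj₁ z ℕP.≟ proj₁ p ⌋ ∧_)
    (allB-++ (nonBlocking p z) (p ∷ P) (allB-true (nonBlocking p z) (All.map outside I<0)))
  where
  outside : ∀ {w} → ℤ.Negative (proj₂ w) → nonBlocking p z w ≡ true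
  outside {w} w<0 rewrite inRect-below p z w p≥0 z≥0 w<0 = refl

module MirrorTree {n : ℕ} (g : Fin n → ℕ) where

  mirrorPoint : Fin n → Point
  mirrorPoint j = (g j , -[1+ toℕ j ])

  searchPoint : Fin n → Point
  searchPoint j = (g j , + suc (toℕ j))

  mirrorTree : List Point
  mirrorTree = map mirrorPoint (allFin n)

  SearchedBefore : ℕ → List Point → Set
  SearchedBefore i P = ∀ j → suc (toℕ j) < i → searchPoint j ∈ P

  mirrorPoint-untouched : ∀ {P j₀} → SearchedBefore (suc (toℕ j₀)) P →
    ∀ j → touches (P ++ mirrorTree) (searchPoint j₀) (mirrorPoint j) ≡ false
  mirrorPoint-untouched {P} {j₀} searched j with ℕP.<-cmp (toℕ j) (toℕ j₀)
  ... | tri< j<j₀ _ _ =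
    touches-blocked (searchPoint j₀) (mirrorPoint j) (searchPoint j)
      (∈-++⁺ˡ (searched j (s≤s j<j₀)))
      ((ℕP.m⊓n≤n (g j₀) (g j) , ℕP.m≤n⊔m (g j₀) (g j)) , (-≤+ , +≤+ (s≤s (ℕP.<⇒≤ j<j₀))))
      (λ e → ℕP.<⇒≢ (s≤s j<j₀) (ℤP.+-injective (cong proj₂ e))) (λ ())
  ... | tri≈ _ j≡j₀ _ with toℕ-injective j≡j₀
  ... | refl rewrite ⌊⌋-true (g j ℕP.≟ g j) refl = refl
  mirrorPoint-untouched {P} {j₀} searched j | tri> _ _ j₀<j =
    touches-blocked (searchPoint j₀) (mirrorPoint j) (mirrorPoint j₀)
      (∈-++⁺ʳ P (∈-map⁺ mirrorPoint (∈-allFin j₀)))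
      ((ℕP.m⊓n≤m (g j₀) (g j) , ℕP.m≤m⊔n (g j₀) (g j)) , (-≤- (ℕP.<⇒≤ j₀<j) , -≤+))
      (λ ()) (λ e → ℕP.<⇒≢ j₀<j (ℤP.-[1+-injective (cong proj₂ e)))

  mirrorTree-below : All (ℤ.Negative ∘ proj₂) mirrorTree
  mirrorTree-below = map⁺ (tabulate⁺ _)

  touchedKeys-++-mirrorTree : ∀ {P j₀} →
    All (ℤ.NonNegative ∘ proj₂) P → SearchedBefore (suc (toℕ j₀)) P →
    touchedKeys (P ++ mirrorTree) (g j₀) (+ suc (toℕ j₀)) ≡ touchedKeys P (g j₀) (+ suc (toℕ j₀))
  touchedKeys-++-mirrorTree {P} {j₀} nonNegative searched =
    cong (deduplicate ℕP._≟_ ∘ map proj₁)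
      (filterᵇ-++-rejected (touches (P ++ mirrorTree) (searchPoint j₀)) (touches P (searchPoint j₀))
        (All.map (λ {z} → touches-++-below {P} (searchPoint j₀) z mirrorTree-below _)
                 nonNegative)
        (map⁺ (tabulate⁺ (mirrorPoint-untouched searched))))

  ConsecutiveFrom : ℕ → List (Fin n) → Set
  ConsecutiveFrom i []       = ⊤
  ConsecutiveFrom i (j ∷ js) = suc (toℕ j) ≡ i × ConsecutiveFrom (suc i) js

  tabulate-consecutive : ∀ {m} (f : Fin m → Fin n) i →
    (∀ j → suc (toℕ (f j)) ≡ i + toℕ j) → ConsecutiveFrom i (tabulate f)
  tabulate-consecutive {ℕ.zero}  f i time = _
  tabulate-consecutive {suc m} f i time =
    trans (time Fin.zero) (ℕP.+-identityʳ i) ,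
    tabulate-consecutive (f ∘ Fin.suc) (suc i)
      (λ j → trans (time (Fin.suc j)) (ℕP.+-suc i (toℕ j)))

  SearchedBefore-step : ∀ {P} Q j₀ → SearchedBefore (suc (toℕ j₀)) P →
    SearchedBefore (suc (suc (toℕ j₀))) (searchPoint j₀ ∷ Q ++ P)
  SearchedBefore-step Q j₀ searched j (s≤s j≤j₀) with ℕP.m≤n⇒m<n∨m≡n j≤j₀
  ... | inj₁ j<j₀ = there (∈-++⁺ʳ Q (searched j j<j₀))
  ... | inj₂ j≡j₀ with toℕ-injective (ℕP.suc-injective j≡j₀)
  ... | refl = here refl

  greedyFrom-++-mirrorTree : ∀ P i js →
    ConsecutiveFrom i js → All (ℤ.NonNegative ∘ proj₂) P → SearchedBefore i P →
    greedyFrom (P ++ mirrorTree) i (map g js) ≡ greedyFrom P i (map g js)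
  greedyFrom-++-mirrorTree P i []        _                    _           _        = refl
  greedyFrom-++-mirrorTree P i (j₀ ∷ js) (refl , consecutive) nonNegative searched = begin
    1 + length K′ + greedyFrom (new K′ ++ P ++ mirrorTree) (suc i) (map g js)
      ≡⟨ cong (λ K → 1 + length K + greedyFrom (new K ++ P ++ mirrorTree) (suc i) (map g js))
              (touchedKeys-++-mirrorTree nonNegative searched) ⟩
    1 + length K + greedyFrom (new K ++ P ++ mirrorTree) (suc i) (map g js)
      ≡⟨ cong (λ X → 1 + length K + greedyFrom X (suc i) (map g js))
              (sym (++-assoc (new K) P mirrorTree)) ⟩
    1 + length K + greedyFrom ((new K ++ P) ++ mirrorTree) (suc i) (map g js)
      ≡⟨ cong (1 + length K ℕ.+_)
              (greedyFrom-++-mirrorTree (new K ++ P) (suc i) js consecutive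
                (++⁺ (ℤ.nonNeg ∷ map⁺ (All.universal (λ _ → ℤ.nonNeg) K)) nonNegative)
                (SearchedBefore-step (map (λ k → k , + i) K) j₀ searched)) ⟩
    1 + length K + greedyFrom (new K ++ P) (suc i) (map g js) ∎
    where
    open ≡-Reasoning
    K′ K : List ℕ
    K′ = touchedKeys (P ++ mirrorTree) (g j₀) (+ i)
    K  = touchedKeys P (g j₀) (+ i)
    new : List ℕ → List Point
    new K = (g j₀ , + i) ∷ map (λ k → k , + i) K

  greedyCost-mirrorTree :
    greedyCost mirrorTree (map g (allFin n)) ≡ greedyCost flatTree (map g (allFin n))
  greedyCost-mirrorTree =
    greedyFrom-++-mirrorTree [] 1 (allFin n) (tabulate-consecutive id 1 λ _ → refl) []
      λ { _ (s≤s ()) }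

-- permTree n π and permSeq n π unfold to mirrorTree and map g (allFin n) for g = permKey π.
corollary1 : (n : ℕ) → 1 ≤ n → (π : Permutation′ n) →
    greedyCost (permTree n π) (permSeq n π) ≡ greedyCost flatTree (permSeq n π)
corollary1 n _ π = MirrorTree.greedyCost-mirrorTree (permKey π)
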